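{- Let $K$ be a finite set with $n=|K|\ge2$ and $\phi,\tau\in L[K]$. Then, as polynomials in an indeterminate $t$, $$(t-1)^{\mathrm{mt}_\tau(\phi)}\,t^{\mathrm{rst}_\tau(\phi)}\,(t+1)^{\mathrm{io}_\tau(\phi)}=\sum_{\gamma\in\Phi_\tau(\phi)}(-1)^{n-\ell(\gamma)}\prod_{\substack{1\le i\le\ell(\gamma)\\ 1_\tau,m_\tau\notin\gamma(r_i)}}(\gamma_it+1).$$
   Context: $L[K]$ is the set of linear orders on $K$; an order is identified with the word listing $K$ in increasing order. For $\tau\in L[K]$, $1_\tau$ and $m_\tau$ are the $\tau$-smallest and $\tau$-largest elements of $K$. A skew ribbon shape $\Gamma$ of size $n$ is a sequence of $n$ cells $c_1,\dots,c_n$ in the plane (up to translation) such that each $c_{j+1}$ is immediately east, immediately south, or immediately (diagonally) southeast of $c_j$. Rows $r_1,r_2,\dots$ are numbered from top to bottom; $\ell(\gamma)$ is the number of rows and $\gamma_i$ the number of cells of row $i$. A standard filling (w.r.t. $\tau$) is a bijection $\gamma:\Gamma\to K$ whose values increase with respect to $\tau$ along each row from left to right and along each column from bottom to top; $\gamma(r_i)$ is the set of values in row $i$. $\phi\in L[K]$ fits $\Gamma$ w.r.t. $\tau$ if the filling $\gamma_\phi$ putting the $j$-th letter of $\phi$ in cell $c_j$ is standard w.r.t. $\tau$, and whenever $c_{j+1}$ is strictly southeast of $c_j$ the $j$-th letter of $\phi$ is $\tau$-smaller than the $(j+1)$-st. $\Phi_\tau(\phi)$ is the set of fillings $\gamma_\phi$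 over all skew ribbon shapes $\Gamma$ that $\phi$ fits w.r.t. $\tau$ such that every row contains at most one of $1_\tau,m_\tau$. Let $\phi=\phi_1\cdots\phi_k$ be the factorization of $\phi$ into maximal rising subsequences w.r.t. $\tau$ (cut the word where the next letter is $\tau$-smaller), $\ell_i$ the length of $\phi_i$. Then $\mathrm{mt}_\tau(\phi)=\sum_{i:\ell_i>1}(\ell_i-2)$, $\mathrm{io}_\tau(\phi)=\#\{i:\ell_i=1,\ 1_\tau,m_\tau\notin\phi_i\}$, $\mathrm{rst}_\tau(\phi)=n-2-\mathrm{mt}_\tau(\phi)-\mathrm{io}_\tau(\phi)$. -}

module Defs where

open import Data.Nat using (ℕ; zero; suc; _∸_; _<ᵇ_)
open import Data.Nat.ListAction using (sum)
open import Data.Bool using (Bool; true; false; _∧_; _∨_; not; if_then_else_)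
open import Data.List using (List; []; _∷_; [_]; length; map; concatMap; foldr)
open import Data.Fin using (Fin; toℕ; fromℕ; _≟_)
open import Data.Fin.Permutation using (Permutation′; _⟨$⟩ʳ_; _⟨$⟩ˡ_)
open import Relation.Nullary.Decidable using (⌊_⌋)
open import Algebra.Bundles using (CommutativeRing)
import Algebra.Bundles
import Algebra.Definitions.RawSemiring as RS
open import Level using (Level)

-- A linear order τ on K = Fin n is the word τ(0) τ(1) ... τ(n-1) listing K
-- in increasing order, represented as a permutation: τ ⟨$⟩ʳ i is the i-th
-- smallest element and τ ⟨$⟩ˡ k is the τ-rank of k.

module _ {n : ℕ} (τ : Permutation′ n) where

  _<τ_ : Fin n → Fin n → Bool
  x <τ y = toℕ (τ ⟨$⟩ˡ x) <ᵇ toℕ (τ ⟨$⟩ˡ y)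

word : ∀ {n} → Permutation′ n → List (Fin n)
word {n} φ = map (φ ⟨$⟩ʳ_) (Data.List.allFin n)
  where import Data.List

oneτ : ∀ {m} → Permutation′ (suc m) → Fin (suc m)
oneτ τ = τ ⟨$⟩ʳ Fin.zero
  where import Data.Fin as Fin

maxτ : ∀ {m} → Permutation′ (suc m) → Fin (suc m)
maxτ {m} τ = τ ⟨$⟩ʳ fromℕ m

-- Skew ribbon shapes of size k, up to translation, are the sequences of
-- the k-1 steps c_j → c_{j+1}: E (east), S (south), D (diagonal southeast).

filterᵇ : ∀ {A : Set} → (A → Bool) → List A → List A
filterᵇ p [] = []
filterᵇ p (x ∷ xs) = if p x then x ∷ filterᵇ p xs else filterᵇ p xs

allᵇ : ∀ {A : Set} → (A → Bool) → List A → Bool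
allᵇ p = foldr (λ x b → p x ∧ b) true

data Step : Set where
  E S D : Step

allSteps : ℕ → List (List Step)
allSteps zero = [] ∷ []
allSteps (suc k) = concatMap (λ w → (E ∷ w) ∷ (S ∷ w) ∷ (D ∷ w) ∷ []) (allSteps k)

consHead : ∀ {A : Set} → A → List (List A) → List (List A)
consHead x [] = [ x ] ∷ []
consHead x (r ∷ rs) = (x ∷ r) ∷ rs

-- rows (top to bottom, each left to right) of the filling putting the
-- letters of the word in cells c_1, c_2, ... of the shape given by steps
rowsOf : ∀ {A : Set} → A → List A → List Step → List (List A)
rowsOf x (y ∷ ys) (E ∷ ss) = consHead x (rowsOf y ys ss)
rowsOf x (y ∷ ys) (S ∷ ss) = [ x ] ∷ rowsOf y ys ss
rowsOf x (y ∷ ys) (D ∷ ss) = [ x ] ∷ rowsOf y ys ss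
rowsOf x _ _ = [ x ] ∷ []

-- the filling is standard and diagonal steps increase (φ fits Γ w.r.t. τ).
-- Rows and columns of a ribbon are contiguous runs of E resp. S steps, so
-- it suffices to check consecutive cells.
fitsB : ∀ {n} → Permutation′ n → Fin n → List (Fin n) → List Step → Bool
fitsB τ x (y ∷ ys) (E ∷ ss) = _<τ_ τ x y ∧ fitsB τ y ys ss
fitsB τ x (y ∷ ys) (S ∷ ss) = _<τ_ τ y x ∧ fitsB τ y ys ss
fitsB τ x (y ∷ ys) (D ∷ ss) = _<τ_ τ x y ∧ fitsB τ y ys ss
fitsB τ x _ _ = true

module _ {m : ℕ} (τ φ : Permutation′ (suc (suc m))) where

  private
    n = suc (suc m)
    x₀ : Fin n
    x₀ = φ ⟨$⟩ʳ Data.Fin.zero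
      where import Data.Fin
    xs : List (Fin n)
    xs = map (φ ⟨$⟩ʳ_) (Data.List.tabulate (λ i → Data.Fin.suc i))
      where import Data.List
            import Data.Fin

  _∈ᵇ_ : Fin n → List (Fin n) → Bool
  k ∈ᵇ r = foldr (λ y b → ⌊ k ≟ y ⌋ ∨ b) false r

  rowOK : List (Fin n) → Bool
  rowOK r = not ((oneτ τ ∈ᵇ r) ∧ (maxτ τ ∈ᵇ r))

  rowFree : List (Fin n) → Bool
  rowFree r = not ((oneτ τ ∈ᵇ r) ∨ (maxτ τ ∈ᵇ r))

  rows : List Step → List (List (Fin n))
  rows ss = rowsOf x₀ xs ss

  -- Φ_τ(φ), indexed by the shapes (step sequences) of its fillings
  Φ : List (List Step)
  Φ = filterᵇ (λ ss → fitsB τ x₀ xs ss ∧ allᵇ rowOK (rows ss)) (allSteps (suc m))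

  ℓ : List Step → ℕ
  ℓ ss = length (rows ss)

  runsOf : Fin n → List (Fin n) → List (List (Fin n))
  runsOf x [] = [ x ] ∷ []
  runsOf x (y ∷ ys) = if _<τ_ τ x y then consHead x (runsOf y ys) else [ x ] ∷ runsOf y ys

  runs : List (List (Fin n))
  runs = runsOf x₀ xs

  mt : ℕ
  mt = sum (map (λ r → length r ∸ 2) runs)   -- runs of length 1 contribute 0 anyway

  io : ℕ
  io = length (filterᵇ (λ r → ⌊ length r Data.Nat.≟ 1 ⌋ ∧ rowFree r) runs)
    where import Data.Nat

  rst : ℕ
  rst = n ∸ 2 ∸ mt ∸ io

module RingNotation {c ℓ' : Level} (R : CommutativeRing c ℓ') where
  open CommutativeRing R
  open RS (Algebra.Bundles.Semiring.rawSemiring semiring) public using (_×_; _^_)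

  ∑ : ∀ {A : Set} → List A → (A → Carrier) → Carrier
  ∑ xs f = foldr (λ a r → f a + r) 0# xs

  ∏ : ∀ {A : Set} → List A → (A → Carrier) → Carrier
  ∏ xs f = foldr (λ a r → f a * r) 1# xs

  sgn : ℕ → Carrier
  sgn k = (- 1#) ^ k

module Submission where

-- A shape fitted by φ must start a new row at every τ-descent of φ and may or may not
-- start one at each ascent, and the summand of a filling factorises over its rows as
-- ∏ (-1)^(|r|-1) · (|r| t + 1, or 1 if r holds one of 1_τ, m_τ, or 0 if it holds both).
-- So the right-hand side is a product over the maximal rising runs of φ of the signed
-- weight of all ways of cutting the run into rows.  Reading a run letter by letter, the
-- current row either continues or stops, which gives a two-term recursion solved by the
-- closed form (-1)^k (t-1)^j α; for a whole run of length L ≥ 2 it is (t-1)^(L-2) t^e,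
-- e the number of ends of the run other than 1_τ and m_τ, and for a singleton t+1 or 1.
-- Multiplying over the runs and counting the n letters, two of which are 1_τ and m_τ,
-- turns the exponents into mt, rst and io.

open import Defs
open import Data.Nat using (ℕ; suc; _∸_)
open import Data.List using (length)
open import Data.Fin.Permutation using (Permutation′)
open import Algebra.Bundles using (CommutativeRing)
open import Level using (Level)

open import Data.Nat using (zero; _<ᵇ_; _≤_; z≤n; s≤s)
open import Data.Nat.Properties using (≤-pred; suc-injective; m+n∸m≡n; m+n∸n≡m)
open import Data.Nat.ListAction using (sum)
open import Data.Bool using (Bool; true; false; _∧_; _∨_; not; if_then_else_)
open import Data.Bool.Properties using (∨-assoc; ∨-identityʳ)
open import Data.List using (List; []; _∷_; [_]; _++_; concat; concatMap; map; tabulate)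
open import Data.List.Properties using (length-++; length-map; length-tabulate; ++-assoc; map-cong)
open import Data.List.Relation.Unary.All using (All; []; _∷_)
import Data.List.Relation.Unary.All.Properties as All
open import Data.List.Relation.Unary.Any using (here; there)
open import Data.List.Relation.Unary.AllPairs using (_∷_)
open import Data.List.Relation.Unary.Unique.Propositional using (Unique)
import Data.List.Relation.Unary.Unique.Propositional.Properties as Unique
open import Data.List.Membership.Propositional using (_∈_)
open import Data.List.Membership.Propositional.Properties using (∈-allFin; ∈-map⁺)
open import Data.Fin using (Fin; toℕ; fromℕ; _≟_)
import Data.Fin as Fin
open import Data.Fin.Properties using (toℕ-injective; toℕ-fromℕ; toℕ<n)
open import Data.Fin.Permutation using (_⟨$⟩ʳ_; _⟨$⟩ˡ_; inverseˡ; inverseʳ)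
open import Data.Product using (∃₂; _,_)
open import Data.Empty using (⊥-elim)
open import Relation.Nullary.Decidable using (⌊_⌋; yes; no; dec-false; isYes≗does)
open import Relation.Binary.PropositionalEquality
  using (_≡_; _≢_; refl; sym; trans; cong; cong₂; subst; module ≡-Reasoning)

module _ where
  open import Data.Nat using (_+_)
  open import Data.Nat.Properties using (+-comm; +-suc; +-assoc; +-identityʳ)
  open import Algebra.Properties.CommutativeSemigroup Data.Nat.Properties.+-commutativeSemigroup
    using () renaming (interchange to +-interchange)

  indicator : Bool → ℕ
  indicator true  = 1
  indicator false = 0

  indicator-∨ : ∀ a b → (a ≡ true → b ≡ false) → indicator (a ∨ b) ≡ indicator a + indicator b
  indicator-∨ true  b a⇒¬b rewrite a⇒¬b refl = refl
  indicator-∨ false b _                       = refl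

  <ᵇ-asym : ∀ a b → (a <ᵇ b) ≡ true → (b <ᵇ a) ≡ false
  <ᵇ-asym zero    (suc b) _  = refl
  <ᵇ-asym (suc a) (suc b) eq = <ᵇ-asym a b eq

  <ᵇ-connex : ∀ a b → a ≢ b → (a <ᵇ b) ≡ false → (b <ᵇ a) ≡ true
  <ᵇ-connex zero    zero    a≢b _  = ⊥-elim (a≢b refl)
  <ᵇ-connex (suc a) zero    _   _  = refl
  <ᵇ-connex (suc a) (suc b) a≢b eq = <ᵇ-connex a b (λ a≡b → a≢b (cong suc a≡b)) eq

  ≤⇒≮ᵇ : ∀ {a b} → b ≤ a → (a <ᵇ b) ≡ false
  ≤⇒≮ᵇ z≤n       = refl
  ≤⇒≮ᵇ (s≤s b≤a) = ≤⇒≮ᵇ b≤a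

  module _ {A : Set} where

    sum-map-+ : ∀ (f g : A → ℕ) xs →
                sum (map (λ x → f x + g x) xs) ≡ sum (map f xs) + sum (map g xs)
    sum-map-+ f g []       = refl
    sum-map-+ f g (x ∷ xs) =
      trans (cong (f x + g x +_) (sum-map-+ f g xs)) (+-interchange (f x) (g x) _ _)

    length-concat : ∀ (xss : List (List A)) → length (concat xss) ≡ sum (map length xss)
    length-concat []         = refl
    length-concat (xs ∷ xss) = trans (length-++ xs) (cong (length xs +_) (length-concat xss))

    length-filterᵇ : ∀ p (xs : List A) → length (filterᵇ p xs) ≡ sum (map (λ x → indicator (p x)) xs)
    length-filterᵇ p []       = refl
    length-filterᵇ p (x ∷ xs) with p x
    ... | true  = cong suc (length-filterᵇ p xs)
    ... | false = length-filterᵇ p xs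

    length-snoc : ∀ (xs : List A) x → length (xs ++ [ x ]) ≡ suc (length xs)
    length-snoc xs x = trans (length-++ xs) (+-comm (length xs) 1)

    data NonEmpty : List A → Set where
      nonEmpty : ∀ {x xs} → NonEmpty (x ∷ xs)

    length-concat-nonEmpty : ∀ {xss : List (List A)} → All NonEmpty xss →
                             length (concat xss) ≡ sum (map (λ xs → length xs ∸ 1) xss) + length xss
    length-concat-nonEmpty [] = refl
    length-concat-nonEmpty {(x ∷ xs) ∷ xss} (nonEmpty ∷ ne) = begin
      suc (length (xs ++ concat xss))          ≡⟨ cong suc (length-++ xs) ⟩
      suc (length xs + length (concat xss))    ≡⟨ cong (λ n → suc (length xs + n)) (length-concat-nonEmpty ne) ⟩
      suc (length xs + (Σ + length xss))       ≡⟨ cong suc (+-assoc (length xs) Σ _) ⟨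
      suc (length xs + Σ + length xss)         ≡⟨ +-suc (length xs + Σ) (length xss) ⟨
      length xs + Σ + suc (length xss)         ∎
      where
        open ≡-Reasoning
        Σ = sum (map (λ xs → length xs ∸ 1) xss)

    consHead-nonEmpty : ∀ (x : A) {xss} → All NonEmpty xss → All NonEmpty (consHead x xss)
    consHead-nonEmpty x []       = nonEmpty ∷ []
    consHead-nonEmpty x (_ ∷ ne) = nonEmpty ∷ ne

    concat-consHead : ∀ (x : A) xss → concat (consHead x xss) ≡ x ∷ concat xss
    concat-consHead x []        = refl
    concat-consHead x (_ ∷ _)   = refl

    rowsOf-nonEmpty : ∀ (x : A) ys ss → All NonEmpty (rowsOf x ys ss)
    rowsOf-nonEmpty x []       ss       = nonEmpty ∷ []
    rowsOf-nonEmpty x (y ∷ ys) []       = nonEmpty ∷ []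
    rowsOf-nonEmpty x (y ∷ ys) (E ∷ ss) = consHead-nonEmpty x (rowsOf-nonEmpty y ys ss)
    rowsOf-nonEmpty x (y ∷ ys) (S ∷ ss) = nonEmpty ∷ rowsOf-nonEmpty y ys ss
    rowsOf-nonEmpty x (y ∷ ys) (D ∷ ss) = nonEmpty ∷ rowsOf-nonEmpty y ys ss

    concat-rowsOf : ∀ (x : A) ys ss → length ss ≡ length ys → concat (rowsOf x ys ss) ≡ x ∷ ys
    concat-rowsOf x []       ss       _  = refl
    concat-rowsOf x (y ∷ ys) (E ∷ ss) eq =
      trans (concat-consHead x (rowsOf y ys ss)) (cong (x ∷_) (concat-rowsOf y ys ss (suc-injective eq)))
    concat-rowsOf x (y ∷ ys) (S ∷ ss) eq = cong (x ∷_) (concat-rowsOf y ys ss (suc-injective eq))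
    concat-rowsOf x (y ∷ ys) (D ∷ ss) eq = cong (x ∷_) (concat-rowsOf y ys ss (suc-injective eq))

  allSteps-length : ∀ k → All (λ ss → length ss ≡ k) (allSteps k)
  allSteps-length zero    = refl ∷ []
  allSteps-length (suc k) =
    All.concat⁺ (All.gmap⁺ (λ eq → let l = cong suc eq in l ∷ l ∷ l ∷ []) (allSteps-length k))

  -- A rising run of length L, holding 1_τ iff A and m_τ iff B, contributes
  -- (t-1)^(L-2) t^(tExponent L A B) (t+1)^(indicator (isolated L A B)) to the left-hand side.
  isolated : ℕ → Bool → Bool → Bool
  isolated L A B = ⌊ L Data.Nat.≟ 1 ⌋ ∧ not (A ∨ B)

  tExponent : ℕ → Bool → Bool → ℕ
  tExponent (suc (suc _)) false false = 2
  tExponent (suc (suc _)) true  false = 1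
  tExponent (suc (suc _)) false true  = 1
  tExponent _             _     _     = 0

  isolated-long : ∀ j A B → isolated (suc (suc j)) A B ≡ false
  isolated-long j A B = cong (_∧ not (A ∨ B)) (trans (isYes≗does 2+j≟1) (dec-false 2+j≟1 λ ()))
    where 2+j≟1 = suc (suc j) Data.Nat.≟ 1

  singleton-length-split : ∀ A B → (A ∧ B) ≡ false →
    1 ≡ (indicator A + indicator B) + (0 + (indicator (isolated 1 A B) + tExponent 1 A B))
  singleton-length-split false false _ = refl
  singleton-length-split true  false _ = refl
  singleton-length-split false true  _ = refl

  long-length-split : ∀ j A B →
    suc (suc j) ≡ (indicator A + indicator B)
                  + (j + (indicator (isolated (suc (suc j)) A B) + tExponent (suc (suc j)) A B))
  long-length-split j A B rewrite isolated-long j A B = split A B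
    where
      split : ∀ A B → suc (suc j) ≡ (indicator A + indicator B) + (j + tExponent (suc (suc j)) A B)
      split false false = +-comm 2 j
      split true  false = cong suc (+-comm 1 j)
      split false true  = cong suc (+-comm 1 j)
      split true  true  = cong (2 +_) (sym (+-identityʳ j))

module BigOperators {c ℓ′ : Level} (R : CommutativeRing c ℓ′) where
  open CommutativeRing R renaming (refl to ≈-refl; sym to ≈-sym; trans to ≈-trans)
  open RingNotation R
  open import Algebra.Properties.Semiring.Exp semiring using (^-homo-*)
  open import Algebra.Properties.CommutativeSemigroup +-commutativeSemigroup
    using () renaming (interchange to +-interchange)
  open import Algebra.Properties.CommutativeSemigroup *-commutativeSemigroup
    using () renaming (interchange to *-interchange)

  when : Bool → Carrier → Carrier
  when b x = if b then x else 0#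

  when-cong : ∀ b {x y} → x ≈ y → when b x ≈ when b y
  when-cong true  x≈y = x≈y
  when-cong false _   = ≈-refl

  when-∧ : ∀ a b x y → when (a ∧ b) (x * y) ≈ when a x * when b y
  when-∧ true  true  x y = ≈-refl
  when-∧ true  false x y = ≈-sym (zeroʳ x)
  when-∧ false b     x y = ≈-sym (zeroˡ (when b y))

  module _ {A : Set} where

    ∑-cong : ∀ xs {f g : A → Carrier} → (∀ x → f x ≈ g x) → ∑ xs f ≈ ∑ xs g
    ∑-cong []       f≈g = ≈-refl
    ∑-cong (x ∷ xs) f≈g = +-cong (f≈g x) (∑-cong xs f≈g)

    ∑-cong-All : ∀ {P : A → Set} {xs} {f g : A → Carrier} →
                 (∀ {x} → P x → f x ≈ g x) → All P xs → ∑ xs f ≈ ∑ xs g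
    ∑-cong-All f≈g []         = ≈-refl
    ∑-cong-All f≈g (px ∷ pxs) = +-cong (f≈g px) (∑-cong-All f≈g pxs)

    ∑-++ : ∀ xs ys (f : A → Carrier) → ∑ (xs ++ ys) f ≈ ∑ xs f + ∑ ys f
    ∑-++ []       ys f = ≈-sym (+-identityˡ _)
    ∑-++ (x ∷ xs) ys f = ≈-trans (+-congˡ (∑-++ xs ys f)) (≈-sym (+-assoc _ _ _))

    ∑-+ : ∀ xs (f g : A → Carrier) → ∑ xs (λ x → f x + g x) ≈ ∑ xs f + ∑ xs g
    ∑-+ []       f g = ≈-sym (+-identityˡ 0#)
    ∑-+ (x ∷ xs) f g = ≈-trans (+-congˡ (∑-+ xs f g)) (+-interchange (f x) (g x) _ _)

    ∑-*ˡ : ∀ xs k (f : A → Carrier) → ∑ xs (λ x → k * f x) ≈ k * ∑ xs f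
    ∑-*ˡ []       k f = ≈-sym (zeroʳ k)
    ∑-*ˡ (x ∷ xs) k f = ≈-trans (+-congˡ (∑-*ˡ xs k f)) (≈-sym (distribˡ k _ _))

    ∑-filterᵇ : ∀ p xs (f : A → Carrier) → ∑ (filterᵇ p xs) f ≈ ∑ xs (λ x → when (p x) (f x))
    ∑-filterᵇ p []       f = ≈-refl
    ∑-filterᵇ p (x ∷ xs) f with p x
    ... | true  = +-congˡ (∑-filterᵇ p xs f)
    ... | false = ≈-trans (∑-filterᵇ p xs f) (≈-sym (+-identityˡ _))

    ∏-cong : ∀ xs {f g : A → Carrier} → (∀ x → f x ≈ g x) → ∏ xs f ≈ ∏ xs g
    ∏-cong []       f≈g = ≈-refl
    ∏-cong (x ∷ xs) f≈g = *-cong (f≈g x) (∏-cong xs f≈g)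

    ∏-cong-All : ∀ {P : A → Set} {xs} {f g : A → Carrier} →
                 (∀ {x} → P x → f x ≈ g x) → All P xs → ∏ xs f ≈ ∏ xs g
    ∏-cong-All f≈g []         = ≈-refl
    ∏-cong-All f≈g (px ∷ pxs) = *-cong (f≈g px) (∏-cong-All f≈g pxs)

    ∏-* : ∀ xs (f g : A → Carrier) → ∏ xs (λ x → f x * g x) ≈ ∏ xs f * ∏ xs g
    ∏-* []       f g = ≈-sym (*-identityˡ 1#)
    ∏-* (x ∷ xs) f g = ≈-trans (*-congˡ (∏-* xs f g)) (*-interchange (f x) (g x) _ _)

    ∏-^ : ∀ xs a (e : A → ℕ) → ∏ xs (λ x → a ^ e x) ≈ a ^ sum (map e xs)
    ∏-^ []       a e = ≈-refl
    ∏-^ (x ∷ xs) a e = ≈-trans (*-congˡ (∏-^ xs a e)) (≈-sym (^-homo-* a (e x) _))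

    ∏-filterᵇ : ∀ p xs (f : A → Carrier) → ∏ (filterᵇ p xs) f ≈ ∏ xs (λ x → if p x then f x else 1#)
    ∏-filterᵇ p []       f = ≈-refl
    ∏-filterᵇ p (x ∷ xs) f with p x
    ... | true  = *-congˡ (∏-filterᵇ p xs f)
    ... | false = ≈-trans (∏-filterᵇ p xs f) (≈-sym (*-identityˡ _))

    when-allᵇ : ∀ p xs (f : A → Carrier) → when (allᵇ p xs) (∏ xs f) ≈ ∏ xs (λ x → when (p x) (f x))
    when-allᵇ p []       f = ≈-refl
    when-allᵇ p (x ∷ xs) f = ≈-trans (when-∧ (p x) (allᵇ p xs) (f x) _) (*-congˡ (when-allᵇ p xs f))

  ∑-concatMap : ∀ {A B : Set} (g : A → List B) xs (f : B → Carrier) →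
                ∑ (concatMap g xs) f ≈ ∑ xs (λ x → ∑ (g x) f)
  ∑-concatMap g []       f = ≈-refl
  ∑-concatMap g (x ∷ xs) f = ≈-trans (∑-++ (g x) (concatMap g xs) f) (+-congˡ (∑-concatMap g xs f))

  ∑-allSteps-suc : ∀ (f : List Step → Carrier) k →
    ∑ (allSteps (suc k)) f ≈ ∑ (allSteps k) (λ w → f (E ∷ w) + (f (S ∷ w) + (f (D ∷ w) + 0#)))
  ∑-allSteps-suc f k = ∑-concatMap _ (allSteps k) f

module RunWeights {c ℓ′ : Level} (R : CommutativeRing c ℓ′) (t : CommutativeRing.Carrier R) where
  open CommutativeRing R renaming (refl to ≈-refl; sym to ≈-sym; trans to ≈-trans)
  open RingNotation R
  open BigOperators R using (when)
  open import Relation.Binary.Reasoning.Setoid setoid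
  open import Algebra.Solver.Ring.NaturalCoefficients.Default commutativeSemiring
    using (solve; _:=_; _:+_; _:*_; con)

  d : Carrier
  d = t - 1#

  rowFactor : ℕ → Bool → Bool → Carrier
  rowFactor p false false = p × t + 1#
  rowFactor p true  false = 1#
  rowFactor p false true  = 1#
  rowFactor p true  true  = 0#

  -- (-1)^(n-ℓ) is split as ∏ (-1)^(|r|-1) over the rows; weight 0 excludes the rows
  -- that Φ forbids.
  rowWeight : ℕ → Bool → Bool → Carrier
  rowWeight p A B = sgn (p ∸ 1) * rowFactor p A B

  rowWeight-when : ∀ L A B →
    rowWeight L A B ≈ when (not (A ∧ B)) (sgn (L ∸ 1) * (if not (A ∨ B) then L × t + 1# else 1#))
  rowWeight-when L false false = ≈-refl
  rowWeight-when L true  false = ≈-refl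
  rowWeight-when L false true  = ≈-refl
  rowWeight-when L true  true  = zeroʳ (sgn (L ∸ 1))

  runCofactor : ℕ → Bool → Bool → Carrier
  runCofactor k false false = suc k × t * t
  runCofactor k true  false = t
  runCofactor k false true  = suc k × t
  runCofactor k true  true  = 1#

  -- runWeight k A B j is the signed weight of all cuttings into rows of a rising run of j
  -- cells whose first row is preceded by k further cells (A: 1_τ lies in that first row,
  -- B: m_τ lies in the run).  The closed form is justified by runWeight-split; j = 0 is junk.
  runWeight : ℕ → Bool → Bool → ℕ → Carrier
  runWeight k A B zero          = 0#
  runWeight k A B 1             = rowWeight (suc k) A B
  runWeight k A B (suc (suc j)) = sgn k * (d ^ j * runCofactor k A B)

  private
    rowFactor-split : ∀ k A B →
      runCofactor k A B + rowFactor (suc (suc k)) A B ≈ rowFactor (suc k) A false * rowFactor 1 false B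
    rowFactor-split k false false =
      solve 2 (λ t u → (t :+ u) :* t :+ ((t :+ (t :+ u)) :+ con 1)
                    := ((t :+ u) :+ con 1) :* ((t :+ con 0) :+ con 1)) ≈-refl t (k × t)
    rowFactor-split k true  false =
      solve 1 (λ t → t :+ con 1 := con 1 :* ((t :+ con 0) :+ con 1)) ≈-refl t
    rowFactor-split k false true  =
      solve 2 (λ t u → (t :+ u) :+ con 1 := ((t :+ u) :+ con 1) :* con 1) ≈-refl t (k × t)
    rowFactor-split k true  true  =
      solve 0 (con 1 :+ con 0 := con 1 :* con 1) ≈-refl

    runCofactor-split : ∀ k A B →
      t * runCofactor k A B + runCofactor (suc k) A B
        ≈ runCofactor k A B + rowFactor (suc k) A false * runCofactor 0 false B
    runCofactor-split k false false =
      solve 2 (λ t u → t :* ((t :+ u) :* t) :+ (t :+ (t :+ u)) :* t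
                    := (t :+ u) :* t :+ ((t :+ u) :+ con 1) :* ((t :+ con 0) :* t)) ≈-refl t (k × t)
    runCofactor-split k true  false =
      solve 1 (λ t → t :* t :+ t := t :+ con 1 :* ((t :+ con 0) :* t)) ≈-refl t
    runCofactor-split k false true  =
      solve 2 (λ t u → t :* (t :+ u) :+ (t :+ (t :+ u))
                    := (t :+ u) :+ ((t :+ u) :+ con 1) :* (t :+ con 0)) ≈-refl t (k × t)
    runCofactor-split k true  true  =
      solve 1 (λ t → t :* con 1 :+ con 1 := con 1 :+ con 1 :* (t :+ con 0)) ≈-refl t

    -1*x+x≈0 : ∀ x → - 1# * x + x ≈ 0#
    -1*x+x≈0 x = begin
      - 1# * x + x      ≈⟨ +-congˡ (*-identityˡ x) ⟨
      - 1# * x + 1# * x ≈⟨ distribʳ x (- 1#) 1# ⟨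
      (- 1# + 1#) * x   ≈⟨ *-congʳ (-‿inverseˡ 1#) ⟩
      0# * x            ≈⟨ zeroˡ x ⟩
      0#                ∎

    signed-split : ∀ σ X Y Z → X + Y ≈ Z → σ * X ≈ (- 1# * σ) * Y + σ * Z
    signed-split σ X Y Z X+Y≈Z = begin
      σ * X                               ≈⟨ +-identityʳ _ ⟨
      σ * X + 0#                          ≈⟨ +-congˡ (-1*x+x≈0 (σ * Y)) ⟨
      σ * X + (- 1# * (σ * Y) + σ * Y)    ≈⟨ solve 4 (λ n s x y → s :* x :+ (n :* (s :* y) :+ s :* y)
                                                               := (n :* s) :* y :+ s :* (x :+ y))
                                                     ≈-refl (- 1#) σ X Y ⟩
      (- 1# * σ) * Y + σ * (X + Y)        ≈⟨ +-congˡ (*-congˡ X+Y≈Z) ⟩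
      (- 1# * σ) * Y + σ * Z              ∎

    d-cancel : ∀ X Y Z → t * X + Y ≈ X + Z → d * X + Y ≈ Z
    d-cancel X Y Z tX+Y≈X+Z = begin
      d * X + Y                ≈⟨ solve 4 (λ t n x y → (t :+ n) :* x :+ y := (t :* x :+ y) :+ n :* x)
                                          ≈-refl t (- 1#) X Y ⟩
      (t * X + Y) + - 1# * X   ≈⟨ +-congʳ tX+Y≈X+Z ⟩
      (X + Z) + - 1# * X       ≈⟨ solve 3 (λ n x z → (x :+ z) :+ n :* x := z :+ (n :* x :+ x))
                                          ≈-refl (- 1#) X Z ⟩
      Z + (- 1# * X + X)       ≈⟨ +-congˡ (-1*x+x≈0 X) ⟩
      Z + 0#                   ≈⟨ +-identityʳ Z ⟩
      Z                        ∎

  -- The first row of the run either continues past the run's first cell or stops there.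
  runWeight-split : ∀ k A B j →
    runWeight k A B (suc (suc j))
      ≈ runWeight (suc k) A B (suc j) + rowWeight (suc k) A false * runWeight 0 false B (suc j)
  runWeight-split k A B zero = begin
    σ * (1# * α)                            ≈⟨ *-congˡ (*-identityˡ α) ⟩
    σ * α                                   ≈⟨ signed-split σ α _ _ (rowFactor-split k A B) ⟩
    (- 1# * σ) * F₂ + σ * (F₁ * F)          ≈⟨ +-congˡ (solve 3 (λ s a b → s :* (a :* b)
                                                                    := (s :* a) :* (con 1 :* b)) ≈-refl σ F₁ F) ⟩
    (- 1# * σ) * F₂ + (σ * F₁) * (1# * F)   ∎
    where
      σ = sgn k
      α = runCofactor k A B
      F₁ = rowFactor (suc k) A false
      F₂ = rowFactor (suc (suc k)) A B
      F = rowFactor 1 false B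
  runWeight-split k A B (suc j) = begin
    σ * ((d * P) * α)
      ≈⟨ *-congˡ (solve 3 (λ d p a → (d :* p) :* a := p :* (d :* a)) ≈-refl d P α) ⟩
    σ * (P * (d * α))
      ≈⟨ signed-split σ _ _ _ (≈-trans (≈-sym (distribˡ P _ _))
                                       (*-congˡ (d-cancel α _ _ (runCofactor-split k A B)))) ⟩
    (- 1# * σ) * (P * α′) + σ * (P * (F₁ * α₀))
      ≈⟨ +-congˡ (solve 4 (λ s p f a → s :* (p :* (f :* a)) := (s :* f) :* (con 1 :* (p :* a)))
                         ≈-refl σ P F₁ α₀) ⟩
    (- 1# * σ) * (P * α′) + (σ * F₁) * (1# * (P * α₀)) ∎
    where
      σ = sgn k
      P = d ^ j
      α = runCofactor k A B
      α′ = runCofactor (suc k) A B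
      α₀ = runCofactor 0 false B
      F₁ = rowFactor (suc k) A false

  runMonomial : ℕ → Bool → Bool → Carrier
  runMonomial L A B = d ^ (L ∸ 2) * t ^ tExponent L A B * (t + 1#) ^ indicator (isolated L A B)

  runWeight-singleton : ∀ A B → (A ∧ B) ≡ false → runWeight 0 A B 1 ≈ runMonomial 1 A B
  runWeight-singleton false false _ =
    solve 1 (λ t → con 1 :* ((t :+ con 0) :+ con 1) := con 1 :* con 1 :* ((t :+ con 1) :* con 1)) ≈-refl t
  runWeight-singleton true  false _ = solve 0 (con 1 :* con 1 := con 1 :* con 1 :* con 1) ≈-refl
  runWeight-singleton false true  _ = solve 0 (con 1 :* con 1 := con 1 :* con 1 :* con 1) ≈-refl

  runWeight-long : ∀ j A B → runWeight 0 A B (suc (suc j)) ≈ runMonomial (suc (suc j)) A B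
  runWeight-long j A B rewrite isolated-long j A B = long A B
    where
      long : ∀ A B → runWeight 0 A B (suc (suc j)) ≈ d ^ j * t ^ tExponent (suc (suc j)) A B * 1#
      long false false =
        solve 2 (λ p t → con 1 :* (p :* ((t :+ con 0) :* t)) := p :* (t :* (t :* con 1)) :* con 1) ≈-refl (d ^ j) t
      long true  false =
        solve 2 (λ p t → con 1 :* (p :* t) := p :* (t :* con 1) :* con 1) ≈-refl (d ^ j) t
      long false true  =
        solve 2 (λ p t → con 1 :* (p :* (t :+ con 0)) := p :* (t :* con 1) :* con 1) ≈-refl (d ^ j) t
      long true  true  =
        solve 1 (λ p → con 1 :* (p :* con 1) := p :* con 1 :* con 1) ≈-refl (d ^ j)

module Words {m : ℕ} (τ φ : Permutation′ (suc (suc m))) where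
  open import Data.Nat using (_+_)
  open import Data.Product using (_×_)

  private
    N = suc (suc m)

  rank : Fin N → ℕ
  rank x = toℕ (τ ⟨$⟩ˡ x)

  <τ-asym : ∀ {x y} → _<τ_ τ x y ≡ true → _<τ_ τ y x ≡ false
  <τ-asym {x} {y} = <ᵇ-asym (rank x) (rank y)

  <τ-connex : ∀ {x y} → x ≢ y → _<τ_ τ x y ≡ false → _<τ_ τ y x ≡ true
  <τ-connex {x} {y} x≢y = <ᵇ-connex (rank x) (rank y) λ eq →
    x≢y (trans (sym (inverseʳ τ)) (trans (cong (τ ⟨$⟩ʳ_) (toℕ-injective eq)) (inverseʳ τ)))

  ≮τ-oneτ : ∀ z → _<τ_ τ z (oneτ τ) ≡ false
  ≮τ-oneτ z rewrite inverseˡ τ {Fin.zero} = ≤⇒≮ᵇ {rank z} z≤n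

  maxτ-≮τ : ∀ z → _<τ_ τ (maxτ τ) z ≡ false
  maxτ-≮τ z rewrite inverseˡ τ {fromℕ (suc m)} | toℕ-fromℕ (suc m) = ≤⇒≮ᵇ (≤-pred (toℕ<n (τ ⟨$⟩ˡ z)))

  oneτ≢maxτ : oneτ τ ≢ maxτ τ
  oneτ≢maxτ eq with trans (sym (inverseˡ τ {Fin.zero})) (trans (cong (τ ⟨$⟩ˡ_) eq) (inverseˡ τ))
  ... | ()

  <τ⇒oneτ≢ : ∀ {x y} → _<τ_ τ x y ≡ true → oneτ τ ≢ y
  <τ⇒oneτ≢ {x} x<y refl with trans (sym x<y) (≮τ-oneτ x)
  ... | ()

  <τ⇒maxτ≢ : ∀ {x y} → _<τ_ τ x y ≡ true → maxτ τ ≢ x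
  <τ⇒maxτ≢ {y = y} x<y refl with trans (sym x<y) (maxτ-≮τ y)
  ... | ()

  ⌊≟⌋-false : ∀ {x y : Fin N} → x ≢ y → ⌊ x ≟ y ⌋ ≡ false
  ⌊≟⌋-false {x} {y} x≢y = trans (isYes≗does (x ≟ y)) (dec-false (x ≟ y) x≢y)

  hasMin hasMax : List (Fin N) → Bool
  hasMin r = _∈ᵇ_ τ φ (oneτ τ) r
  hasMax r = _∈ᵇ_ τ φ (maxτ τ) r

  ∈ᵇ-++ : ∀ z r l → _∈ᵇ_ τ φ z (r ++ l) ≡ (_∈ᵇ_ τ φ z r ∨ _∈ᵇ_ τ φ z l)
  ∈ᵇ-++ z []      l = refl
  ∈ᵇ-++ z (y ∷ r) l = trans (cong (⌊ z ≟ y ⌋ ∨_) (∈ᵇ-++ z r l)) (sym (∨-assoc ⌊ z ≟ y ⌋ _ _))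

  ∈⇒∈ᵇ : ∀ {z l} → z ∈ l → _∈ᵇ_ τ φ z l ≡ true
  ∈⇒∈ᵇ {z} {y ∷ l} z∈y∷l with z ≟ y | z∈y∷l
  ... | yes _   | _         = refl
  ... | no z≢y  | here z≡y  = ⊥-elim (z≢y z≡y)
  ... | no _    | there z∈l = ∈⇒∈ᵇ z∈l

  ∉⇒∉ᵇ : ∀ {z l} → All (z ≢_) l → _∈ᵇ_ τ φ z l ≡ false
  ∉⇒∉ᵇ []          = refl
  ∉⇒∉ᵇ (z≢y ∷ z∉l) rewrite ⌊≟⌋-false z≢y = ∉⇒∉ᵇ z∉l

  ∈ᵇ-++-absentʳ : ∀ z p {l} → _∈ᵇ_ τ φ z l ≡ false → _∈ᵇ_ τ φ z (p ++ l) ≡ _∈ᵇ_ τ φ z p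
  ∈ᵇ-++-absentʳ z p z∉l = trans (∈ᵇ-++ z p _) (trans (cong (_ ∨_) z∉l) (∨-identityʳ _))

  hasMax-++-∷ : ∀ p {x l} → hasMax p ≡ false → maxτ τ ≢ x → hasMax (p ++ x ∷ l) ≡ hasMax l
  hasMax-++-∷ p {x} {l} m∉p m≢x =
    trans (∈ᵇ-++ (maxτ τ) p (x ∷ l)) (cong₂ (λ a b → a ∨ (b ∨ hasMax l)) m∉p (⌊≟⌋-false m≢x))

  not-both-singleton : ∀ z → (hasMin [ z ] ∧ hasMax [ z ]) ≡ false
  not-both-singleton z with oneτ τ ≟ z | maxτ τ ≟ z
  ... | yes 1≡z | yes m≡z = ⊥-elim (oneτ≢maxτ (trans 1≡z (sym m≡z)))
  ... | yes _   | no _    = refl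
  ... | no _    | _       = refl

  -- The word of φ as its first letter and the rest, exactly as in the (private)
  -- definitions of Φ, rows and runs.
  x₀ : Fin N
  x₀ = φ ⟨$⟩ʳ Fin.zero

  xs : List (Fin N)
  xs = map (φ ⟨$⟩ʳ_) (tabulate Fin.suc)

  length-xs : length xs ≡ suc m
  length-xs = trans (length-map (φ ⟨$⟩ʳ_) (tabulate Fin.suc)) (length-tabulate Fin.suc)

  word-unique : Unique (x₀ ∷ xs)
  word-unique = Unique.map⁺ φ-injective (Unique.allFin⁺ N)
    where
      φ-injective : ∀ {i j} → φ ⟨$⟩ʳ i ≡ φ ⟨$⟩ʳ j → i ≡ j
      φ-injective eq = trans (sym (inverseˡ φ)) (trans (cong (φ ⟨$⟩ˡ_) eq) (inverseˡ φ))

  ∈-word : ∀ z → z ∈ x₀ ∷ xs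
  ∈-word z = subst (_∈ x₀ ∷ xs) (inverseʳ φ) (∈-map⁺ (φ ⟨$⟩ʳ_) (∈-allFin (φ ⟨$⟩ˡ z)))

  runsOf-head : ∀ y ys → ∃₂ λ hr tl → runsOf τ φ y ys ≡ (y ∷ hr) ∷ tl × hasMin hr ≡ false
  runsOf-head y []       = [] , [] , refl , refl
  runsOf-head y (z ∷ zs) with _<τ_ τ y z in y<z
  ... | false = [] , runsOf τ φ z zs , refl , refl
  ... | true with runsOf-head z zs
  ...   | hr , tl , eq , 1∉hr rewrite eq =
          z ∷ hr , tl , refl , trans (cong (_∨ hasMin hr) (⌊≟⌋-false (<τ⇒oneτ≢ y<z))) 1∉hr

  runsOf-nonEmpty : ∀ x ys → All NonEmpty (runsOf τ φ x ys)
  runsOf-nonEmpty x []       = nonEmpty ∷ []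
  runsOf-nonEmpty x (y ∷ ys) with _<τ_ τ x y
  ... | true  = consHead-nonEmpty x (runsOf-nonEmpty y ys)
  ... | false = nonEmpty ∷ runsOf-nonEmpty y ys

  concat-runsOf : ∀ x ys → concat (runsOf τ φ x ys) ≡ x ∷ ys
  concat-runsOf x []       = refl
  concat-runsOf x (y ∷ ys) with _<τ_ τ x y
  ... | true  = trans (concat-consHead x (runsOf τ φ y ys)) (cong (x ∷_) (concat-runsOf y ys))
  ... | false = cong (x ∷_) (concat-runsOf y ys)

  private
    unique-++⁻ʳ : ∀ r {l : List (Fin N)} → Unique (r ++ l) → Unique l
    unique-++⁻ʳ []      u       = u
    unique-++⁻ʳ (_ ∷ r) (_ ∷ u) = unique-++⁻ʳ r u

    ∈ᵇ-disjoint : ∀ {z} r {l} → Unique (r ++ l) → _∈ᵇ_ τ φ z r ≡ true → _∈ᵇ_ τ φ z l ≡ false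
    ∈ᵇ-disjoint {z} (y ∷ r) (y∉r++l ∷ u) z∈y∷r with z ≟ y
    ... | yes refl = ∉⇒∉ᵇ (All.++⁻ʳ r y∉r++l)
    ... | no _     = ∈ᵇ-disjoint r u z∈y∷r

  sum-indicator-∈ᵇ : ∀ z rs → Unique (concat rs) →
    sum (map (λ r → indicator (_∈ᵇ_ τ φ z r)) rs) ≡ indicator (_∈ᵇ_ τ φ z (concat rs))
  sum-indicator-∈ᵇ z []       _ = refl
  sum-indicator-∈ᵇ z (r ∷ rs) u = begin
    indicator (z ∈? r) + sum (map (λ r → indicator (z ∈? r)) rs)
      ≡⟨ cong (indicator (z ∈? r) +_) (sum-indicator-∈ᵇ z rs (unique-++⁻ʳ r u)) ⟩
    indicator (z ∈? r) + indicator (z ∈? concat rs)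
      ≡⟨ indicator-∨ (z ∈? r) _ (∈ᵇ-disjoint r u) ⟨
    indicator (z ∈? r ∨ z ∈? concat rs)
      ≡⟨ cong indicator (∈ᵇ-++ z r (concat rs)) ⟨
    indicator (z ∈? (r ++ concat rs))
      ∎
    where
      open ≡-Reasoning
      _∈?_ = _∈ᵇ_ τ φ

  exactly-one-run-contains : ∀ z → sum (map (λ r → indicator (_∈ᵇ_ τ φ z r)) (runs τ φ)) ≡ 1
  exactly-one-run-contains z =
    trans (sum-indicator-∈ᵇ z (runs τ φ) (subst Unique (sym concat-runs) word-unique))
          (cong indicator (∈⇒∈ᵇ (subst (z ∈_) (sym concat-runs) (∈-word z))))
    where concat-runs = concat-runsOf x₀ xs

  tExp : List (Fin N) → ℕ
  tExp r = tExponent (length r) (hasMin r) (hasMax r)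

  run-length-split : ∀ r →
    length r ≡ (indicator (hasMin r) + indicator (hasMax r))
               + ((length r ∸ 2) + (indicator (isolated (length r) (hasMin r) (hasMax r)) + tExp r))
  run-length-split []              = refl
  run-length-split (z ∷ [])        = singleton-length-split (hasMin [ z ]) (hasMax [ z ]) (not-both-singleton z)
  run-length-split r@(_ ∷ _ ∷ r′) = long-length-split (length r′) (hasMin r) (hasMax r)

  length-word-split : suc (suc m) ≡ 2 + (mt τ φ + (io τ φ + sum (map tExp (runs τ φ))))
  length-word-split = begin
    suc (suc m)                                   ≡⟨ cong suc length-xs ⟨
    length (x₀ ∷ xs)                              ≡⟨ cong length (concat-runsOf x₀ xs) ⟨
    length (concat rs)                            ≡⟨ length-concat rs ⟩
    sum (map length rs)                           ≡⟨ cong sum (map-cong run-length-split rs) ⟩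
    Σ (λ r → (iMin r + iMax r) + (f r + (h r + tExp r)))
      ≡⟨ trans (sum-map-+ _ _ rs) (cong₂ _+_ (sum-map-+ iMin iMax rs)
               (trans (sum-map-+ f _ rs) (cong (Σ f +_) (sum-map-+ h tExp rs)))) ⟩
    (Σ iMin + Σ iMax) + (Σ f + (Σ h + Σ tExp))
      ≡⟨ cong₂ _+_ (cong₂ _+_ (exactly-one-run-contains (oneτ τ)) (exactly-one-run-contains (maxτ τ)))
                   (cong (λ k → Σ f + (k + Σ tExp)) (sym (length-filterᵇ _ rs))) ⟩
    2 + (mt τ φ + (io τ φ + Σ tExp))              ∎
    where
      open ≡-Reasoning
      rs = runs τ φ
      Σ : (List (Fin N) → ℕ) → ℕ
      Σ g = sum (map g rs)
      iMin iMax f h : List (Fin N) → ℕ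
      iMin r = indicator (hasMin r)
      iMax r = indicator (hasMax r)
      f r = length r ∸ 2
      h r = indicator (isolated (length r) (hasMin r) (hasMax r))

  rst≡sum-tExp : rst τ φ ≡ sum (map tExp (runs τ φ))
  rst≡sum-tExp = begin
    rst τ φ                         ≡⟨ cong (λ n → n ∸ 2 ∸ M ∸ I) length-word-split ⟩
    2 + (M + (I + G)) ∸ 2 ∸ M ∸ I   ≡⟨ cong (λ n → n ∸ M ∸ I) (m+n∸m≡n 2 _) ⟩
    M + (I + G) ∸ M ∸ I             ≡⟨ cong (_∸ I) (m+n∸m≡n M _) ⟩
    I + G ∸ I                       ≡⟨ m+n∸m≡n I G ⟩
    G                               ∎
    where
      open ≡-Reasoning
      M = mt τ φ
      I = io τ φ
      G = sum (map tExp (runs τ φ))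

module Fillings {c ℓ′ : Level} (R : CommutativeRing c ℓ′) {m : ℕ} (τ φ : Permutation′ (suc (suc m)))
                (t : CommutativeRing.Carrier R) where
  open CommutativeRing R renaming (refl to ≈-refl; sym to ≈-sym; trans to ≈-trans)
  open RingNotation R
  open BigOperators R
  open RunWeights R t
  open Words τ φ
  open import Relation.Binary.Reasoning.Setoid setoid

  Row : Set
  Row = List (Fin (suc (suc m)))

  weightOfRow : Row → Carrier
  weightOfRow r = rowWeight (length r) (hasMin r) (hasMax r)

  glue : Row → List Row → List Row
  glue p []       = [ p ]
  glue p (r ∷ rs) = (p ++ r) ∷ rs

  glue-consHead : ∀ p x rs → glue p (consHead x rs) ≡ glue (p ++ [ x ]) rs
  glue-consHead p x []       = refl
  glue-consHead p x (r ∷ rs) = cong (_∷ rs) (sym (++-assoc p [ x ] r))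

  glue-[]-rowsOf : ∀ x ys ss → glue [] (rowsOf x ys ss) ≡ rowsOf x ys ss
  glue-[]-rowsOf x []       ss       = refl
  glue-[]-rowsOf x (y ∷ ys) []       = refl
  glue-[]-rowsOf x (y ∷ ys) (E ∷ ss) with rowsOf y ys ss
  ... | []    = refl
  ... | _ ∷ _ = refl
  glue-[]-rowsOf x (y ∷ ys) (S ∷ ss) = refl
  glue-[]-rowsOf x (y ∷ ys) (D ∷ ss) = refl

  -- transferSum p x ys: signed weight of the fillings of every shape fitted by x ∷ ys,
  -- with the cells p glued in front of the first row.
  shapeWeight : Row → Fin (suc (suc m)) → Row → List Step → Carrier
  shapeWeight p x ys ss = when (fitsB τ x ys ss) (∏ (glue p (rowsOf x ys ss)) weightOfRow)

  transferSum : Row → Fin (suc (suc m)) → Row → Carrier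
  transferSum p x ys = ∑ (allSteps (length ys)) (shapeWeight p x ys)

  -- The summands of the steps E, S, D between x and y: at an ascent S does not fit, at a
  -- descent only S does.
  private
    ascent-step : ∀ {xy yx} f {E′ D′ G′ H′ W′} → xy ≡ true → yx ≡ false → E′ ≈ G′ → D′ ≈ W′ * H′ →
      when (xy ∧ f) E′ + (when (yx ∧ f) D′ + (when (xy ∧ f) D′ + 0#)) ≈ when f G′ + W′ * when f H′
    ascent-step true  refl refl E≈G D≈WH =
      +-cong E≈G (≈-trans (+-identityˡ _) (≈-trans (+-identityʳ _) D≈WH))
    ascent-step false refl refl _   _    =
      +-congˡ (≈-trans (+-identityˡ _) (≈-trans (+-identityʳ 0#) (≈-sym (zeroʳ _))))

    descent-step : ∀ {xy yx} f {E′ D′ H′ W′} → xy ≡ false → yx ≡ true → D′ ≈ W′ * H′ →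
      when (xy ∧ f) E′ + (when (yx ∧ f) D′ + (when (xy ∧ f) D′ + 0#)) ≈ W′ * when f H′
    descent-step true  refl refl D≈WH =
      ≈-trans (+-identityˡ _) (≈-trans (+-congˡ (+-identityˡ 0#)) (≈-trans (+-identityʳ _) D≈WH))
    descent-step false refl refl _    =
      ≈-trans (+-identityˡ _) (≈-trans (+-identityˡ _) (≈-trans (+-identityʳ 0#) (≈-sym (zeroʳ _))))

  ∏-glue-[] : ∀ y ys w → ∏ (rowsOf y ys w) weightOfRow ≈ ∏ (glue [] (rowsOf y ys w)) weightOfRow
  ∏-glue-[] y ys w = reflexive (cong (λ rs → ∏ rs weightOfRow) (sym (glue-[]-rowsOf y ys w)))

  transferSum-ascent : ∀ p {x y} ys → _<τ_ τ x y ≡ true →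
    transferSum p x (y ∷ ys) ≈ transferSum (p ++ [ x ]) y ys + weightOfRow (p ++ [ x ]) * transferSum [] y ys
  transferSum-ascent p {x} {y} ys x<y = begin
    transferSum p x (y ∷ ys)
      ≈⟨ ∑-allSteps-suc _ (length ys) ⟩
    _
      ≈⟨ ∑-cong Ss split ⟩
    ∑ Ss (λ w → shapeWeight (p ++ [ x ]) y ys w + W * shapeWeight [] y ys w)
      ≈⟨ ∑-+ Ss _ _ ⟩
    transferSum (p ++ [ x ]) y ys + ∑ Ss (λ w → W * shapeWeight [] y ys w)
      ≈⟨ +-congˡ (∑-*ˡ Ss W _) ⟩
    transferSum (p ++ [ x ]) y ys + W * transferSum [] y ys
      ∎
    where
      Ss = allSteps (length ys)
      W = weightOfRow (p ++ [ x ])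
      split : ∀ w → _
      split w = ascent-step (fitsB τ y ys w) x<y (<τ-asym x<y)
        (reflexive (cong (λ rs → ∏ rs weightOfRow) (glue-consHead p x (rowsOf y ys w))))
        (*-congˡ (∏-glue-[] y ys w))

  transferSum-descent : ∀ p {x y} ys → x ≢ y → _<τ_ τ x y ≡ false →
    transferSum p x (y ∷ ys) ≈ weightOfRow (p ++ [ x ]) * transferSum [] y ys
  transferSum-descent p {x} {y} ys x≢y x≮y = begin
    transferSum p x (y ∷ ys)                  ≈⟨ ∑-allSteps-suc _ (length ys) ⟩
    _                                         ≈⟨ ∑-cong Ss split ⟩
    ∑ Ss (λ w → W * shapeWeight [] y ys w)    ≈⟨ ∑-*ˡ Ss W _ ⟩
    W * transferSum [] y ys                   ∎
    where
      Ss = allSteps (length ys)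
      W = weightOfRow (p ++ [ x ])
      split : ∀ w → _
      split w = descent-step (fitsB τ y ys w) x≮y (<τ-connex x≢y x≮y) (*-congˡ (∏-glue-[] y ys w))

  prefixedRunWeight : Row → Row → Carrier
  prefixedRunWeight p r = runWeight (length p) (hasMin (p ++ r)) (hasMax (p ++ r)) (length r)

  prefixedRunsWeight : Row → List Row → Carrier
  prefixedRunsWeight p []       = 1#
  prefixedRunsWeight p (r ∷ rs) = prefixedRunWeight p r * ∏ rs (prefixedRunWeight [])

  prefixedRunsWeight-[] : ∀ rs → prefixedRunsWeight [] rs ≡ ∏ rs (prefixedRunWeight [])
  prefixedRunsWeight-[] []      = refl
  prefixedRunsWeight-[] (_ ∷ _) = refl

  weightOfRow-snoc : ∀ p x → weightOfRow (p ++ [ x ]) ≡ prefixedRunWeight p [ x ]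
  weightOfRow-snoc p x =
    cong (λ L → rowWeight L (hasMin (p ++ [ x ])) (hasMax (p ++ [ x ]))) (length-snoc p x)

  prefixedRunWeight-split : ∀ p {x y} hr →
    hasMax p ≡ false → _<τ_ τ x y ≡ true → hasMin (y ∷ hr) ≡ false →
    prefixedRunWeight p (x ∷ y ∷ hr)
      ≈ prefixedRunWeight (p ++ [ x ]) (y ∷ hr) + weightOfRow (p ++ [ x ]) * prefixedRunWeight [] (y ∷ hr)
  prefixedRunWeight-split p {x} {y} hr m∉p x<y 1∉y∷hr = begin
    runWeight k A B (suc (suc (length hr)))
      ≈⟨ runWeight-split k A B (length hr) ⟩
    runWeight (suc k) A B (suc (length hr)) + rowWeight (suc k) A false * runWeight 0 false B (suc (length hr))
      ≡⟨ cong₂ _+_ first-row-continues (cong₂ _*_ first-row-stops next-row) ⟨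
    prefixedRunWeight (p ++ [ x ]) (y ∷ hr) + weightOfRow (p ++ [ x ]) * prefixedRunWeight [] (y ∷ hr)
      ∎
    where
      k = length p
      A = hasMin (p ++ x ∷ y ∷ hr)
      B = hasMax (p ++ x ∷ y ∷ hr)
      m≢x = <τ⇒maxτ≢ x<y

      first-row-continues : prefixedRunWeight (p ++ [ x ]) (y ∷ hr) ≡ runWeight (suc k) A B (suc (length hr))
      first-row-continues = cong₂ (λ L q → runWeight L (hasMin q) (hasMax q) (suc (length hr)))
                                  (length-snoc p x) (++-assoc p [ x ] (y ∷ hr))

      first-row-stops : weightOfRow (p ++ [ x ]) ≡ rowWeight (suc k) A false
      first-row-stops = trans (weightOfRow-snoc p x) (cong₂ (rowWeight (suc k))
        (trans (sym (∈ᵇ-++-absentʳ (oneτ τ) (p ++ [ x ]) 1∉y∷hr)) (cong hasMin (++-assoc p [ x ] (y ∷ hr))))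
        (hasMax-++-∷ p m∉p m≢x))

      next-row : prefixedRunWeight [] (y ∷ hr) ≡ runWeight 0 false B (suc (length hr))
      next-row = cong₂ (λ a b → runWeight 0 a b (suc (length hr))) 1∉y∷hr (sym (hasMax-++-∷ p m∉p m≢x))

  transferSum≈prefixedRunsWeight : ∀ p x ys → hasMax p ≡ false → Unique (x ∷ ys) →
    transferSum p x ys ≈ prefixedRunsWeight p (runsOf τ φ x ys)
  transferSum≈prefixedRunsWeight p x [] _ _ =
    ≈-trans (+-identityʳ _) (*-congʳ (reflexive (weightOfRow-snoc p x)))
  transferSum≈prefixedRunsWeight p x (y ∷ ys) m∉p ((x≢y ∷ _) ∷ u) with _<τ_ τ x y in x<y
  ... | false = begin
    transferSum p x (y ∷ ys)
      ≈⟨ transferSum-descent p ys x≢y x<y ⟩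
    W * transferSum [] y ys
      ≈⟨ *-cong (reflexive (weightOfRow-snoc p x)) (rest [] refl) ⟩
    prefixedRunWeight p [ x ] * prefixedRunsWeight [] rs
      ≡⟨ cong (prefixedRunWeight p [ x ] *_) (prefixedRunsWeight-[] rs) ⟩
    prefixedRunsWeight p ([ x ] ∷ rs)
      ∎
    where
      W = weightOfRow (p ++ [ x ])
      rs = runsOf τ φ y ys
      rest : ∀ q → hasMax q ≡ false → transferSum q y ys ≈ prefixedRunsWeight q rs
      rest q m∉q = transferSum≈prefixedRunsWeight q y ys m∉q u
  ... | true with runsOf-head y ys
  ...   | hr , tl , rs≡ , 1∉hr = begin
    transferSum p x (y ∷ ys)
      ≈⟨ transferSum-ascent p ys x<y ⟩
    transferSum (p ++ [ x ]) y ys + W * transferSum [] y ys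
      ≈⟨ +-cong (rest (p ++ [ x ]) (hasMax-++-∷ p m∉p (<τ⇒maxτ≢ x<y))) (*-congˡ (rest [] refl)) ⟩
    prefixedRunsWeight (p ++ [ x ]) rs + W * prefixedRunsWeight [] rs
      ≡⟨ cong (λ rs → prefixedRunsWeight (p ++ [ x ]) rs + W * prefixedRunsWeight [] rs) rs≡ ⟩
    continued * Π + W * (stopped * Π)
      ≈⟨ +-congˡ (*-assoc W stopped Π) ⟨
    continued * Π + W * stopped * Π
      ≈⟨ distribʳ Π continued (W * stopped) ⟨
    (continued + W * stopped) * Π
      ≈⟨ *-congʳ (prefixedRunWeight-split p hr m∉p x<y 1∉y∷hr) ⟨
    prefixedRunWeight p (x ∷ y ∷ hr) * Π
      ≡⟨ cong (λ rs → prefixedRunsWeight p (consHead x rs)) rs≡ ⟨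
    prefixedRunsWeight p (consHead x rs)
      ∎
    where
      W = weightOfRow (p ++ [ x ])
      rs = runsOf τ φ y ys
      continued = prefixedRunWeight (p ++ [ x ]) (y ∷ hr)
      stopped = prefixedRunWeight [] (y ∷ hr)
      Π = ∏ tl (prefixedRunWeight [])
      rest : ∀ q → hasMax q ≡ false → transferSum q y ys ≈ prefixedRunsWeight q rs
      rest q m∉q = transferSum≈prefixedRunsWeight q y ys m∉q u
      1∉y∷hr : hasMin (y ∷ hr) ≡ false
      1∉y∷hr = cong₂ _∨_ (⌊≟⌋-false (<τ⇒oneτ≢ x<y)) 1∉hr

  freeRowFactor : Row → Carrier
  freeRowFactor r = length r × t + 1#

  signedFilling : List Step → Carrier
  signedFilling ss = sgn (suc (suc m) ∸ ℓ τ φ ss) * ∏ (filterᵇ (rowFree τ φ) (rows τ φ ss)) freeRowFactor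

  signedRows≈∏weightOfRow : ∀ rs → All NonEmpty rs →
    when (allᵇ (rowOK τ φ) rs) (sgn (length (concat rs) ∸ length rs) * ∏ (filterᵇ (rowFree τ φ) rs) freeRowFactor)
      ≈ ∏ rs weightOfRow
  signedRows≈∏weightOfRow rs ne = begin
    when (allᵇ ok rs) (sgn (length (concat rs) ∸ length rs) * ∏ (filterᵇ free rs) freeRowFactor)
      ≡⟨ cong (λ e → when (allᵇ ok rs) (sgn e * ∏ (filterᵇ free rs) freeRowFactor))
              (trans (cong (_∸ length rs) (length-concat-nonEmpty ne)) (m+n∸n≡m _ (length rs))) ⟩
    when (allᵇ ok rs) (sgn (sum (map (λ r → length r ∸ 1) rs)) * ∏ (filterᵇ free rs) freeRowFactor)
      ≈⟨ when-cong (allᵇ ok rs) (*-cong (≈-sym (∏-^ rs (- 1#) (λ r → length r ∸ 1)))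
                                        (∏-filterᵇ free rs freeRowFactor)) ⟩
    when (allᵇ ok rs) (∏ rs (λ r → sgn (length r ∸ 1)) * ∏ rs factor)
      ≈⟨ when-cong (allᵇ ok rs) (≈-sym (∏-* rs _ _)) ⟩
    when (allᵇ ok rs) (∏ rs (λ r → sgn (length r ∸ 1) * factor r))
      ≈⟨ when-allᵇ ok rs _ ⟩
    ∏ rs (λ r → when (ok r) (sgn (length r ∸ 1) * factor r))
      ≈⟨ ∏-cong rs (λ r → ≈-sym (rowWeight-when (length r) (hasMin r) (hasMax r))) ⟩
    ∏ rs weightOfRow
      ∎
    where
      ok free : Row → Bool
      ok = rowOK τ φ
      free = rowFree τ φ
      factor : Row → Carrier
      factor r = if free r then freeRowFactor r else 1#

  fillings≈transferSum : ∑ (Φ τ φ) signedFilling ≈ transferSum [] x₀ xs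
  fillings≈transferSum = begin
    ∑ (Φ τ φ) signedFilling
      ≈⟨ ∑-filterᵇ _ (allSteps (suc m)) signedFilling ⟩
    ∑ (allSteps (suc m)) (λ ss → when (fitsB τ x₀ xs ss ∧ allOK ss) (signedFilling ss))
      ≈⟨ ∑-cong-All (λ {ss} → shape {ss}) (allSteps-length (suc m)) ⟩
    ∑ (allSteps (suc m)) (shapeWeight [] x₀ xs)
      ≡⟨ cong (λ k → ∑ (allSteps k) (shapeWeight [] x₀ xs)) length-xs ⟨
    transferSum [] x₀ xs
      ∎
    where
      allOK : List Step → Bool
      allOK ss = allᵇ (rowOK τ φ) (rows τ φ ss)

      shape : ∀ {ss} → length ss ≡ suc m →
        when (fitsB τ x₀ xs ss ∧ allOK ss) (signedFilling ss) ≈ shapeWeight [] x₀ xs ss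
      shape {ss} len with fitsB τ x₀ xs ss
      ... | false = ≈-refl
      ... | true  = begin
        when (allOK ss) (signedFilling ss)
          ≡⟨ cong (λ n → when (allOK ss) (sgn (n ∸ length rs) * ∏ (filterᵇ (rowFree τ φ) rs) freeRowFactor))
                  (trans (cong suc (sym length-xs)) (cong length (sym concat-rs))) ⟩
        when (allOK ss) (sgn (length (concat rs) ∸ length rs) * ∏ (filterᵇ (rowFree τ φ) rs) freeRowFactor)
          ≈⟨ signedRows≈∏weightOfRow rs (rowsOf-nonEmpty x₀ xs ss) ⟩
        ∏ rs weightOfRow
          ≡⟨ cong (λ rs → ∏ rs weightOfRow) (glue-[]-rowsOf x₀ xs ss) ⟨
        ∏ (glue [] rs) weightOfRow
          ∎
        where
          rs = rows τ φ ss
          concat-rs = concat-rowsOf x₀ xs ss (trans len (sym length-xs))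

  run≈runMonomial : ∀ {r} → NonEmpty r → prefixedRunWeight [] r ≈ runMonomial (length r) (hasMin r) (hasMax r)
  run≈runMonomial {z ∷ []}         nonEmpty =
    runWeight-singleton (hasMin [ z ]) (hasMax [ z ]) (not-both-singleton z)
  run≈runMonomial {r@(_ ∷ _ ∷ r′)} nonEmpty = runWeight-long (length r′) (hasMin r) (hasMax r)

  ∏runs≈lhs : ∏ (runs τ φ) (prefixedRunWeight []) ≈ (t - 1#) ^ mt τ φ * t ^ rst τ φ * (t + 1#) ^ io τ φ
  ∏runs≈lhs = begin
    ∏ rs (prefixedRunWeight [])
      ≈⟨ ∏-cong-All run≈runMonomial (runsOf-nonEmpty x₀ xs) ⟩
    ∏ rs (λ r → d ^ (length r ∸ 2) * t ^ tExp r * (t + 1#) ^ h r)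
      ≈⟨ ≈-trans (∏-* rs _ _) (*-congʳ (∏-* rs _ _)) ⟩
    ∏ rs (λ r → d ^ (length r ∸ 2)) * ∏ rs (λ r → t ^ tExp r) * ∏ rs (λ r → (t + 1#) ^ h r)
      ≈⟨ *-cong (*-cong (∏-^ rs d _) (∏-^ rs t tExp)) (∏-^ rs (t + 1#) h) ⟩
    d ^ mt τ φ * t ^ sum (map tExp rs) * (t + 1#) ^ sum (map h rs)
      ≡⟨ cong₂ (λ a b → d ^ mt τ φ * t ^ a * (t + 1#) ^ b) rst≡sum-tExp (length-filterᵇ _ rs) ⟨
    d ^ mt τ φ * t ^ rst τ φ * (t + 1#) ^ io τ φ
      ∎
    where
      rs = runs τ φ
      h : Row → ℕ
      h r = indicator (isolated (length r) (hasMin r) (hasMax r))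

theorem6p4 : ∀ {c ℓ' : Level} (R : CommutativeRing c ℓ') (m : ℕ)
               (τ φ : Permutation′ (suc (suc m)))
               (t : CommutativeRing.Carrier R) →
             let open CommutativeRing R
                 open RingNotation R
             in ((t - 1#) ^ mt τ φ) * (t ^ rst τ φ) * ((t + 1#) ^ io τ φ)
                ≈ ∑ (Φ τ φ) (λ γ →
                    sgn (suc (suc m) ∸ ℓ τ φ γ)
                    * ∏ (filterᵇ (rowFree τ φ) (rows τ φ γ))
                        (λ r → (length r × t) + 1#))
theorem6p4 R m τ φ t = begin
  (t - 1#) ^ mt τ φ * t ^ rst τ φ * (t + 1#) ^ io τ φ
    ≈⟨ ∏runs≈lhs ⟨
  ∏ (runs τ φ) (prefixedRunWeight [])
    ≡⟨ prefixedRunsWeight-[] (runs τ φ) ⟨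
  prefixedRunsWeight [] (runs τ φ)
    ≈⟨ transferSum≈prefixedRunsWeight [] x₀ xs refl word-unique ⟨
  transferSum [] x₀ xs
    ≈⟨ fillings≈transferSum ⟨
  ∑ (Φ τ φ) signedFilling
    ∎
  where
    open CommutativeRing R renaming (refl to ≈-refl; sym to ≈-sym; trans to ≈-trans)
    open RingNotation R
    open Words τ φ using (x₀; xs; word-unique)
    open Fillings R τ φ t
    open import Relation.Binary.Reasoning.Setoid setoid
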